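{- Let $\tau$ be a correct translation. Then the prefix of $\tau(!)$ cannot be $T_2^+P_2$.
   Context: SYNCSIMPLE: subprocesses $U ::= \checkmark \mid 0 \mid\ !U \mid\ ?U$; processes are parallel compositions (multisets) of subprocesses; reduction $!U_1 \mid ?U_2 \mid P \to U_1 \mid U_2 \mid P$; successful = has a parallel component $\checkmark$; may-convergent = reduces to a successful process; must-convergent = every reduct is may-convergent. LOCKSIMPLE$_{2,IS}$: two locks, each full ($\blacksquare$) or empty ($\Box$), initial store $IS$; subprocesses $U ::= 0 \mid \checkmark \mid P_iU \mid T_iU$ ($i\in\{1,2\}$); $P_i$ on empty lock $i$ fills it, on a full lock blocks; $T_i$ never blocks and empties lock $i$. Convergence evaluated from $(P,IS)$. $\tau$ is a compositional translation SYNCSIMPLE $\to$ LOCKSIMPLE$_{2,IS}$ ($\tau(0)=0$, $\tau(\checkmark)=\checkmark$, $\tau$ commutes with parallel composition, $\tau(!U)=\tau(!)\tau(U)$, $\tau(?U)=\tau(?)\tau(U)$); correct = preserve and reflect may- and must-convergence. Standing assumption: $\tau$ has blocking type $(P_1P_1,P_2P_2)$, i.e. $\tau(!)$ executed alone from $IS$ deadlocks exactly before the second $P_1$ of a prefix $R_1P_1R_2P_1$ with $R_2$ free of $P_1,T_1$, and $\tau(?)$ executed alone from $IS$ deadlocks exactly before the second $P_2$ of a prefix $R_3P_2R_4P_2$ with $R_4$ free of $P_2,T_2$. $T_2^+$ denotes one or more $T_2$. -}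

module Defs where

open import Data.Bool using (Bool; true; false; if_then_else_)
open import Data.Nat using (ℕ; suc)
open import Data.List using (List; []; _∷_; _++_; map; foldr; replicate)
open import Data.List.Membership.Propositional using (_∈_)
open import Data.List.Relation.Binary.Permutation.Propositional using (_↭_)
open import Data.Maybe using (Maybe; just; nothing)
open import Data.Product using (Σ; ∃; _×_; _,_; proj₁)
open import Function.Bundles using (_⇔_)
open import Relation.Binary.Construct.Closure.ReflexiveTransitive using (Star)
open import Relation.Binary.PropositionalEquality using (_≡_)
open import Relation.Nullary using (¬_)

data SU : Set where
  ✓ 𝟘 : SU
  send recv : SU → SU      -- send u = !u , recv u = ?u

-- processes: multisets of subprocesses, represented as lists
-- (all notions below are invariant under permutation)
SProc : Set
SProc = List SU

data _⟶S_ : SProc → SProc → Set where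
  sync : ∀ {Ps u₁ u₂ R} → Ps ↭ (send u₁ ∷ recv u₂ ∷ R) → Ps ⟶S (u₁ ∷ u₂ ∷ R)

SuccessfulS : SProc → Set
SuccessfulS Ps = ✓ ∈ Ps

MayS : SProc → Set
MayS Ps = ∃ λ Q → Star _⟶S_ Ps Q × SuccessfulS Q

MustS : SProc → Set
MustS Ps = ∀ Q → Star _⟶S_ Ps Q → MayS Q

data Lock : Set where
  l₁ l₂ : Lock

data Act : Set where
  P T : Lock → Act

data LU : Set where
  ✓ₗ 𝟘ₗ : LU
  _▹_ : Act → LU → LU

infixr 5 _▹_

LProc : Set
LProc = List LU

-- store: true = full (■), false = empty (□)
Store : Set
Store = Lock → Bool

set : Store → Lock → Bool → Store
set s l₁ b l₁ = b
set s l₁ b l₂ = s l₂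
set s l₂ b l₁ = s l₁
set s l₂ b l₂ = b

Config : Set
Config = LProc × Store

data _⟶L_ : Config → Config → Set where
  put  : ∀ {Ps i u R s} → Ps ↭ ((P i ▹ u) ∷ R) → s i ≡ false →
         (Ps , s) ⟶L (u ∷ R , set s i true)
  take : ∀ {Ps i u R s} → Ps ↭ ((T i ▹ u) ∷ R) →
         (Ps , s) ⟶L (u ∷ R , set s i false)

SuccessfulL : Config → Set
SuccessfulL c = ✓ₗ ∈ proj₁ c

MayL : Config → Set
MayL c = ∃ λ d → Star _⟶L_ c d × SuccessfulL d

MustL : Config → Set
MustL c = ∀ d → Star _⟶L_ c d → MayL d

-- Compositional translations: determined by the words τ(!) and τ(?)

record Translation : Set where
  field
    τ! τ? : List Act
open Translation public

prefix : List Act → LU → LU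
prefix w u = foldr _▹_ u w

trU : Translation → SU → LU
trU t ✓ = ✓ₗ
trU t 𝟘 = 𝟘ₗ
trU t (send u) = prefix (τ! t) (trU t u)
trU t (recv u) = prefix (τ? t) (trU t u)

trP : Translation → SProc → LProc
trP t = map (trU t)

Correct : Store → Translation → Set
Correct IS t = ∀ Ps → (MayS Ps ⇔ MayL (trP t Ps , IS))
                    × (MustS Ps ⇔ MustL (trP t Ps , IS))

-- executing a word of actions alone; nothing = blocks
exec : Store → List Act → Maybe Store
exec s [] = just s
exec s (P i ∷ w) = if s i then nothing else exec (set s i true) w
exec s (T i ∷ w) = exec (set s i false) w

BlocksAt : Store → Lock → List Act → Set
BlocksAt IS i w =
  Σ (List Act) λ R₁ → Σ (List Act) λ R₂ → Σ (List Act) λ rest →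
    (w ≡ R₁ ++ P i ∷ R₂ ++ P i ∷ rest)
  × (¬ (P i ∈ R₂)) × (¬ (T i ∈ R₂))
  × (∃ λ s → exec IS (R₁ ++ P i ∷ R₂) ≡ just s)
  × (exec IS (R₁ ++ P i ∷ R₂ ++ P i ∷ []) ≡ nothing)

BlockingType : Store → Translation → Set
BlockingType IS t = BlocksAt IS l₁ (τ! t) × BlocksAt IS l₂ (τ? t)

StartsT₂⁺P₂ : List Act → Set
StartsT₂⁺P₂ w = Σ ℕ λ k → Σ (List Act) λ rest →
  w ≡ replicate (suc k) (T l₂) ++ P l₂ ∷ rest

-- The encoding !✓ | ?✓ is must-convergent, so its translation must be too. Run τ(?) up to
-- its first P₂ (lock 2 is then empty), let τ(!) perform its leading T₂s (which only
-- empty the already empty lock 2), and run τ(?) on until it blocks before its second P₂.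
-- Now lock 2 is full and both components are waiting on P₂: a deadlock without ✓.
module Submission where

open import Data.Bool using (true; false)
open import Data.List using ([]; _∷_; _++_; replicate)
open import Data.List.Properties using (++-assoc)
open import Data.List.Relation.Binary.Permutation.Propositional using (_↭_; ↭-refl; ↭-sym; ↭-trans; swap)
open import Data.List.Relation.Binary.Permutation.Propositional.Properties using (∈-resp-↭; All-resp-↭)
open import Data.List.Relation.Unary.All as All using (All; []; _∷_)
open import Data.List.Relation.Unary.Any using (here; there)
open import Data.Maybe using (just; nothing; _>>=_)
open import Data.Nat using (zero; suc)
open import Data.Product using (∃; ∃₂; _×_; _,_; proj₂)
open import Function.Bundles using (Equivalence)
open import Relation.Binary.Construct.Closure.ReflexiveTransitive using (Star; ε; _◅_; _◅◅_)
open import Relation.Binary.PropositionalEquality using (_≡_; refl; sym; trans; cong; _≗_; module ≡-Reasoning)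
open import Relation.Nullary using (¬_)

open import Defs

✓-persists : ∀ {Ps Qs} → SuccessfulS Ps → Star _⟶S_ Ps Qs → SuccessfulS Qs
✓-persists ✓∈Ps ε = ✓∈Ps
✓-persists ✓∈Ps (sync p ◅ steps) with ∈-resp-↭ p ✓∈Ps
... | there (there ✓∈R) = ✓-persists (there (there ✓∈R)) steps

!✓∣?✓ : SProc
!✓∣?✓ = send ✓ ∷ recv ✓ ∷ []

!✓∣?✓-must : MustS !✓∣?✓
!✓∣?✓-must _ ε = _ , sync ↭-refl ◅ ε , here refl
!✓∣?✓-must Qs (sync {u₁ = u₁} p ◅ steps) with ∈-resp-↭ (↭-sym p) (here {x = send u₁} refl)
... | here refl        = Qs , ε , ✓-persists (here refl) steps
... | there (here ())
... | there (there ())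

set-cong : ∀ {s s'} i b → s ≗ s' → set s i b ≗ set s' i b
set-cong l₁ b s≗s' l₁ = refl
set-cong l₁ b s≗s' l₂ = s≗s' l₂
set-cong l₂ b s≗s' l₁ = s≗s' l₁
set-cong l₂ b s≗s' l₂ = refl

set-lookup : ∀ s i b → set s i b i ≡ b
set-lookup s l₁ b = refl
set-lookup s l₂ b = refl

set-unchanged : ∀ {s} i {b} → s i ≡ b → set s i b ≗ s
set-unchanged l₁ refl l₁ = refl
set-unchanged l₁ refl l₂ = refl
set-unchanged l₂ refl l₁ = refl
set-unchanged l₂ refl l₂ = refl

P-enabled : ∀ {s i w r} → exec s (P i ∷ w) ≡ just r → s i ≡ false
P-enabled {s} {i} run with s i
P-enabled ()  | true
P-enabled run | false = refl

P-blocked : ∀ {s i} → exec s (P i ∷ []) ≡ nothing → s i ≡ true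
P-blocked {s} {i} run with s i
P-blocked run | true = refl
P-blocked ()  | false

exec-++ : ∀ s u v → exec s (u ++ v) ≡ (exec s u >>= λ m → exec m v)
exec-++ s [] v = refl
exec-++ s (P i ∷ u) v with s i
... | true  = refl
... | false = exec-++ (set s i true) u v
exec-++ s (T i ∷ u) v = exec-++ (set s i false) u v

exec-++-just : ∀ s u v {r} → exec s (u ++ v) ≡ just r →
               ∃ λ m → exec s u ≡ just m × exec m v ≡ just r
exec-++-just s u v run with exec s u | exec-++ s u v
... | just m  | split = m , refl , trans (sym split) run
... | nothing | split with () ← trans (sym split) run

exec-++-after : ∀ s u v {m} → exec s u ≡ just m → exec s (u ++ v) ≡ exec m v
exec-++-after s u v run rewrite exec-++ s u v | run = refl

exec-cong : ∀ w {s s' r} → s ≗ s' → exec s w ≡ just r →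
            ∃ λ r' → exec s' w ≡ just r' × r ≗ r'
exec-cong [] s≗s' refl = _ , refl , s≗s'
exec-cong (P i ∷ w) {s} {s'} s≗s' run with s i in si | s' i in s'i
exec-cong (P i ∷ w) s≗s' () | true | _
exec-cong (P i ∷ w) s≗s' run | false | false = exec-cong w (set-cong i true s≗s') run
exec-cong (P i ∷ w) s≗s' run | false | true with () ← trans (sym si) (trans (s≗s' i) s'i)
exec-cong (T i ∷ w) s≗s' run = exec-cong w (set-cong i false s≗s') run

-- Without function extensionality, emptying an empty lock yields a store that is only
-- pointwise equal to the old one.
exec-Tⁿ : ∀ n {s} i → s i ≡ false → ∃ λ r → exec s (replicate n (T i)) ≡ just r × r ≗ s
exec-Tⁿ zero    i _ = _ , refl , λ _ → refl
exec-Tⁿ (suc n) {s} i si with exec-Tⁿ n {set s i false} i (set-lookup s i false)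
... | r , run , r≗ = r , run , λ l → trans (r≗ l) (set-unchanged i si l)

Tⁿ-before-P : ∀ n {s i w r} → exec s (P i ∷ w) ≡ just r →
              ∃₂ λ s' r' → exec s (replicate n (T i)) ≡ just s' × exec s' (P i ∷ w) ≡ just r' × r ≗ r'
Tⁿ-before-P n {s} {i} {w} run with exec-Tⁿ n i (P-enabled {s} {i} {w} run)
... | s' , runT , s'≗s with exec-cong (P i ∷ w) (λ l → sym (s'≗s l)) run
... | r' , run' , r≗r' = s' , r' , runT , run' , r≗r'

run-prefix : ∀ w w' {u R Ps s s'} → Ps ↭ prefix (w ++ w') u ∷ R → exec s w ≡ just s' →
             ∃ λ Ps' → Star _⟶L_ (Ps , s) (Ps' , s') × Ps' ↭ prefix w' u ∷ R
run-prefix [] w' p refl = _ , ε , p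
run-prefix (P i ∷ w) w' {s = s} p run with s i in si
run-prefix (P i ∷ w) w' p () | true
run-prefix (P i ∷ w) w' p run | false with run-prefix w w' ↭-refl run
... | Ps' , steps , p' = Ps' , put p si ◅ steps , p'
run-prefix (T i ∷ w) w' p run with run-prefix w w' ↭-refl run
... | Ps' , steps , p' = Ps' , take p ◅ steps , p'

BlockedOn : Lock → LU → Set
BlockedOn i u = ∃ λ u' → u ≡ P i ▹ u'

blocked-¬MayL : ∀ {Ps s i} → All (BlockedOn i) Ps → s i ≡ true → ¬ MayL (Ps , s)
blocked-¬MayL blocked full (_ , ε , ✓∈Ps) with All.lookup blocked ✓∈Ps
... | _ , ()
blocked-¬MayL blocked full (_ , put p empty ◅ _ , _) with All.lookup blocked (∈-resp-↭ (↭-sym p) (here refl))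
... | _ , refl with () ← trans (sym empty) full
blocked-¬MayL blocked full (_ , take p ◅ _ , _) with All.lookup blocked (∈-resp-↭ (↭-sym p) (here refl))
... | _ , ()

deadlock-reachable : ∀ n {s i w rest v} x y → w ≡ replicate n (T i) ++ P i ∷ rest → BlocksAt s i v →
  ∃ λ c → Star _⟶L_ (prefix w x ∷ prefix v y ∷ [] , s) c × ¬ MayL c
deadlock-reachable n {s} {i} {rest = rest} x y refl (R₁ , R₂ , R₃ , refl , _ , _ , (s₂ , run₁₂) , stuck)
  with exec-++-just s R₁ (P i ∷ R₂) run₁₂
... | _ , run₁ , run₂ with Tⁿ-before-P n {w = R₂} run₂
... | _ , s₂' , runT , run₂' , s₂≗s₂' with run-prefix R₁ (P i ∷ R₂ ++ P i ∷ R₃) (swap _ _ ↭-refl) run₁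
... | Ps₁ , steps₁ , Ps₁↭ with run-prefix (replicate n (T i)) (P i ∷ rest) (↭-trans Ps₁↭ (swap _ _ ↭-refl)) runT
... | Ps₂ , steps₂ , Ps₂↭ with run-prefix (P i ∷ R₂) (P i ∷ R₃) (↭-trans Ps₂↭ (swap _ _ ↭-refl)) run₂'
... | Ps₃ , steps₃ , Ps₃↭ =
  (Ps₃ , s₂') , steps₁ ◅◅ steps₂ ◅◅ steps₃ ,
  blocked-¬MayL (All-resp-↭ (↭-sym Ps₃↭) ((_ , refl) ∷ (_ , refl) ∷ [])) (trans (sym (s₂≗s₂' i)) s₂-full)
  where
    s₂-full : s₂ i ≡ true
    s₂-full = P-blocked {s₂} {i} (begin
      exec s₂ (P i ∷ [])                        ≡⟨ exec-++-after s (R₁ ++ P i ∷ R₂) (P i ∷ []) run₁₂ ⟨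
      exec s ((R₁ ++ P i ∷ R₂) ++ P i ∷ [])     ≡⟨ cong (exec s) (++-assoc R₁ (P i ∷ R₂) (P i ∷ [])) ⟩
      exec s (R₁ ++ P i ∷ R₂ ++ P i ∷ [])       ≡⟨ stuck ⟩
      nothing                                   ∎)
      where open ≡-Reasoning

lemma5p5 : (IS : Store) (t : Translation) → Correct IS t → BlockingType IS t →
    ¬ StartsT₂⁺P₂ (τ! t)
lemma5p5 IS t correct (_ , τ?-blocks) (k , _ , τ!-shape)
  with deadlock-reachable (suc k) ✓ₗ ✓ₗ τ!-shape τ?-blocks
... | c , steps , ¬may = ¬may (Equivalence.to (proj₂ (correct !✓∣?✓)) !✓∣?✓-must c steps)
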